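{- Let $t\geq 5$ be an integer. For every even integer $\lambda\geq t^3$, there is a canonical territory of perimeter $\lambda$.
   Context: Graphs are finite and simple. A path $P$ has length equal to its number of edges; its ends and middle vertex are as usual. A territory is a pair $(T,B)$ where $T$ is a graph and $B$ is an induced cycle in $T$; its perimeter is the length (number of edges) of $B$. Expansion (with respect to the fixed integer $t\geq 5$). Given a territory $(T',B')$, an expansion of it is any territory $(T,B)$ obtained as follows. Choose, for some integer $k\geq 0$, a stable set $\{x_1,\dots,x_k\}$ of vertices of $B'$ (possibly empty), and for each $i$ let $x_i^-,x_i^+$ be the two neighbours of $x_i$ in $B'$. Choose a subset $I\subseteq\{1,\dots,k\}$. Build $T$ from $T'$ as follows: for each $i\in\{1,\dots,k\}$ add a new path $P_i$ of length $2t-6$ with ends $y_i^-,y_i^+$ and middle vertex $y_i$, and add the edges $x_i^-y_i^-$, $x_iy_i$, $x_i^+y_i^+$; then for each $i\in I$, letting $v_i^-,v_i^+$ be the two neighbours of $y_i$ in $P_i$ (with $v_i^-$ on the side of $y_i^-$), add a new path $Q_i$ of length $t-4$ with ends $z_i^-,z_i^+$ and add the edges $v_i^-z_i^-$, $v_i^+z_i^+$ (all added vertices are new and distinct). For $i\notin I$ let $R_i$ be the path $x_i^-\text{ - }y_i^-\text{ - }P_i\text{ - }y_i^+\text{ - }x_i^+$, and for $i\in I$ let $R_i$ be the path $x_i^-\text{ - }y_i^-\text{ - }(P_i\text{ from }y_i^-\text{ to }v_i^-)\text{ - }z_i^-\text{ - }Q_i\text{ - }z_i^+\text{ - }(P_i\text{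 from }v_i^+\text{ to }y_i^+)\text{ - }x_i^+$. Let $B=(B'\setminus\{x_1,\dots,x_k\})\cup R_1\cup\dots\cup R_k$; this is an induced cycle of $T$, and $(T,B)$ is the expansion. The territories $(T_m,B_m)$, $m\geq 0$: $T_0$ is a $t$-cycle and $B_0=T_0$. For $m\geq 1$, write $N=t(t-3)^{m-1}$ and $B_{m-1}=x_1\text{ - }x_2\text{ - }\cdots\text{ - }x_N\text{ - }x_1$; obtain $T_m$ from $T_{m-1}$ by adding a new cycle $B_m$ which is the $(t-4)$-subdivision of an $N$-cycle $x_1'\text{ - }\cdots\text{ - }x_N'\text{ - }x_1'$ (each edge replaced by a path of length $t-3$), and adding the edges $x_ix_i'$ for $i=1,\dots,N$. Then $(T_m,B_m)$ is a territory of perimeter $t(t-3)^m$. A territory $(T,B)$ is canonical if for some $m\geq 0$ there is an expansion $(T',B')$ of $(T_m,B_m)$ and a graph isomorphism $f:V(T)\to V(T')$ between $T$ and $T'$ whose restriction to $V(B)$ is an isomorphism between $B$ and $B'$. -}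

module Defs where

open import Data.Nat using (ℕ; zero; suc; _+_; _*_; _∸_; _^_; _≤_)
open import Data.Fin using (Fin; toℕ)
open import Data.Bool using (Bool; true; false; _∧_; T)
open import Data.Product using (Σ; ∃; _×_; _,_; proj₁)
open import Data.Sum using (_⊎_; inj₁; inj₂)
open import Data.Empty using (⊥)
open import Data.Unit using (⊤)
open import Relation.Nullary using (¬_)
open import Relation.Binary.PropositionalEquality using (_≡_; _≢_)
open import Function.Bundles using (_⤖_; Bijection; _⇔_)

record Graph (n : ℕ) : Set₁ where
  field
    E     : Fin n → Fin n → Set
    E-sym : ∀ {u v} → E u v → E v u
    E-irr : ∀ {v} → ¬ E v v
open Graph public

Succ : ℕ → ℕ → ℕ → Set
Succ L p q = (suc p ≡ q) ⊎ (suc p ≡ L × q ≡ 0)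

CycAdj : ℕ → ℕ → ℕ → Set
CycAdj L p q = Succ L p q ⊎ Succ L q p

record InducedCycle {n : ℕ} (G : Graph n) : Set where
  field
    len    : ℕ
    len≥3  : 3 ≤ len
    vtx    : Fin len → Fin n
    vtx-inj : ∀ i j → vtx i ≡ vtx j → i ≡ j
    induced : ∀ i j → E G (vtx i) (vtx j) ⇔ CycAdj len (toℕ i) (toℕ j)
open InducedCycle public

InV : ∀ {n} {G : Graph n} → InducedCycle G → Fin n → Set
InV B v = ∃ λ i → vtx B i ≡ v

perimeter : ∀ {n} {G : Graph n} → InducedCycle G → ℕ
perimeter B = len B

-- The territories (T_m , B_m) for fixed t.
-- B_j has length Lm t j = t (t-3)^j; vertex (j , p) is the p-th vertex
-- of B_j (0 ≤ j ≤ m).  The edge x_i x_i' joins (j , i) to (j+1 , i(t-3)).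

Lm : ℕ → ℕ → ℕ
Lm t j = t * (t ∸ 3) ^ j

TmV : ℕ → ℕ → Set
TmV t m = Σ ℕ λ j → j ≤ m × Fin (Lm t j)

TmD : (t m : ℕ) → TmV t m → TmV t m → Set
TmD t m (j , _ , p) (j' , _ , q) =
  (j ≡ j' × Succ (Lm t j) (toℕ p) (toℕ q))
  ⊎ (suc j ≡ j' × toℕ q ≡ toℕ p * (t ∸ 3))

TmE : (t m : ℕ) → TmV t m → TmV t m → Set
TmE t m u v = TmD t m u v ⊎ TmD t m v u

Bm : (t m : ℕ) → Fin (Lm t m) → TmV t m
Bm t m p = (m , Data.Nat.Properties.≤-refl , p)
  where import Data.Nat.Properties

module Expansion (t : ℕ) {V' : Set} (E' : V' → V' → Set)
                 (L' : ℕ) (c' : Fin L' → V') where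

  -- data of an expansion: the stable set {x_1..x_k} of vertices of B'
  -- (as a set S of positions on B') and the subset I of it.
  record Data : Set where
    field
      S      : Fin L' → Bool
      stable : ∀ p q → T (S p) → T (S q) → ¬ CycAdj L' (toℕ p) (toℕ q)
      I      : (Σ (Fin L') λ p → T (S p)) → Bool

  module _ (d : Data) where
    open Data d

    Sel : Set
    Sel = Σ (Fin L') λ p → T (S p)

    -- vertex a of P_i (a = 0 .. 2t-6; y⁻ = 0, y = t-3, y⁺ = 2t-6,
    -- v⁻ = t-4, v⁺ = t-2);  vertex b of Q_i (b = 0 .. t-4; z⁻ = 0, z⁺ = t-4)
    PV : Set
    PV = Sel × Fin (2 * t ∸ 5)

    QV : Set
    QV = (Σ Sel λ s → T (I s)) × Fin (t ∸ 3)

    V : Set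
    V = V' ⊎ (PV ⊎ QV)

    D : V → V → Set
    D (inj₁ u) (inj₁ v) = E' u v
    D (inj₁ u) (inj₂ (inj₁ ((p , _) , a))) =
        (toℕ a ≡ 0 × ∃ λ q → Succ L' (toℕ q) (toℕ p) × u ≡ c' q)
      ⊎ (toℕ a ≡ t ∸ 3 × u ≡ c' p)
      ⊎ (toℕ a ≡ 2 * t ∸ 6 × ∃ λ q → Succ L' (toℕ p) (toℕ q) × u ≡ c' q)
    D (inj₁ u) (inj₂ (inj₂ _)) = ⊥
    D (inj₂ (inj₁ (s , a))) (inj₂ (inj₁ (s' , b))) =
      proj₁ s ≡ proj₁ s' × suc (toℕ a) ≡ toℕ b
    D (inj₂ (inj₁ (s , a))) (inj₂ (inj₂ ((s' , _) , b))) =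
      proj₁ s ≡ proj₁ s' ×
        ((toℕ a ≡ t ∸ 4 × toℕ b ≡ 0) ⊎ (toℕ a ≡ t ∸ 2 × toℕ b ≡ t ∸ 4))
    D (inj₂ (inj₂ ((s , _) , a))) (inj₂ (inj₂ ((s' , _) , b))) =
      proj₁ s ≡ proj₁ s' × suc (toℕ a) ≡ toℕ b
    D (inj₂ _) (inj₁ _) = ⊥
    D (inj₂ (inj₂ _)) (inj₂ (inj₁ _)) = ⊥

    Ex : V → V → Set
    Ex u v = D u v ⊎ D v u

    -- vertex set of the new cycle B = (B' \ {x_i}) ∪ R_1 ∪ … ∪ R_k
    InB : V → Set
    InB (inj₁ u) = ∃ λ q → ¬ T (S q) × c' q ≡ u
    InB (inj₂ (inj₁ (s , a))) = T (I s) → toℕ a ≢ t ∸ 3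
    InB (inj₂ (inj₂ _)) = ⊤

Canonical : (t : ℕ) {n : ℕ} (G : Graph n) (B : InducedCycle G) → Set
Canonical t {n} G B =
  Σ ℕ λ m →
  Σ (Expansion.Data t (TmE t m) (Lm t m) (Bm t m)) λ d →
  let module X = Expansion t (TmE t m) (Lm t m) (Bm t m) in
  Σ (Fin n ⤖ X.V d) λ f →
    (∀ u v → E G u v ⇔ X.Ex d (Bijection.to f u) (Bijection.to f v))
    × (∀ v → InV B v ⇔ X.InB d (Bijection.to f v))

{-# OPTIONS --safe #-}
module Submission where

-- Write u = t − 3 and L = t·u^m for the perimeter of (T_m, B_m).  Expanding a vertex of B_m
-- outside I lengthens the cycle by 2t − 6 = 2u, expanding it inside I by 3t − 10 = 3u − 1.
-- We expand the K = J + M odd positions 1, 3, …, 2K − 1 of B_m, the first J of them inside I;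
-- when 2K < L this set is stable and the new perimeter is L + (3u − 1)J + 2uM.
-- Given an even λ ≥ t³, take m ≥ 2 with L + A ≤ λ < uL + A where A = 2u(3u − 2).  Since
-- 3u ≡ 1 (mod 3u − 1), the number (λ − L − A)/2 + u(3u − 2) is uM + (3u − 1)j with M ≤ 3u − 2;
-- put J = 2j.  The upper bound on λ, together with m ≥ 2, forces 2K < L.
-- The new cycle is enumerated block by block, block r < K being the kept vertex 2r followed by
-- the path replacing vertex 2r + 1.  A position function on all vertices shows that edges
-- between vertices of the cycle join exactly the cyclically consecutive positions.

open import Defs
open import Algebra.Properties.CommutativeSemigroup using (x∙yz≈y∙xz)
open import Data.Bool using (true; false; T)
open import Data.Bool.Properties using (T-irrelevant)
open import Data.Empty using (⊥-elim)
open import Data.Fin using (Fin; toℕ; fromℕ<; _↑ˡ_; _↑ʳ_; combine)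
open import Data.Fin.Properties
  using (+↔⊎; *↔×; 0↔⊥; 1↔⊤; toℕ-injective; toℕ<n; toℕ-fromℕ<; toℕ-↑ˡ; toℕ-↑ʳ; toℕ-combine)
open import Data.Nat
  using (ℕ; zero; suc; _+_; _*_; _∸_; _^_; _⊓_; _≤_; _<_; _≟_; _<?_; _≤?_; ⌊_/2⌋; ⌈_/2⌉; z≤n; s≤s)
open import Data.Nat.Divisibility using (_∣_; divides; ∣m+n∣m⇒∣n; ∣m∣n⇒∣m+n; ∣m⇒∣m*n; m∣m*n; n∣m*n)
open import Data.Nat.Properties
open import Data.Nat.Tactic.RingSolver using (solve-∀)
open import Data.Product using (Σ; ∃; ∃₂; _×_; _,_; proj₁; proj₂)
import Data.Product.Function.Dependent.Propositional as Σ
open import Data.Product.Function.NonDependent.Propositional using (_×-↔_)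
open import Data.Sum using (_⊎_; inj₁; inj₂; [_,_]; swap)
import Data.Sum as Sum
open import Data.Sum.Function.Propositional using (_⊎-↔_)
open import Data.Unit using (⊤; tt)
open import Function using (_∘_; _∋_; id; _↔_; _⤖_; _⇔_; mk⇔; mk↔ₛ′; Inverse; Bijection)
open import Function.Properties.Inverse using (↔-refl; ↔-trans; ↔⇒⤖)
open import Relation.Nullary using (¬_; Dec; yes; no; contradiction)
open import Relation.Nullary.Decidable using (_×-dec_; isYes; toWitness; fromWitness)
open import Relation.Binary.PropositionalEquality
  using (_≡_; _≢_; refl; sym; trans; cong; cong₂; subst; subst₂; ≢-sym)
open ≤-Reasoning

-- Finite types

Finite : Set → Set
Finite A = Σ ℕ λ n → Fin n ↔ A

finite-↔ : ∀ {A B} → Finite A → A ↔ B → Finite B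
finite-↔ (n , f) g = n , ↔-trans f g

finite-Fin : ∀ n → Finite (Fin n)
finite-Fin n = n , ↔-refl

finite-T : ∀ b → Finite (T b)
finite-T true  = 1 , 1↔⊤
finite-T false = 0 , 0↔⊥

finite-⊎ : ∀ {A B} → Finite A → Finite B → Finite (A ⊎ B)
finite-⊎ (m , f) (n , g) = m + n , ↔-trans +↔⊎ (f ⊎-↔ g)

finite-× : ∀ {A B} → Finite A → Finite B → Finite (A × B)
finite-× (m , f) (n , g) = m * n , ↔-trans *↔× (f ×-↔ g)

Fin-suc↔ : ∀ {n} → Fin (suc n) ↔ (⊤ ⊎ Fin n)
Fin-suc↔ = ↔-trans +↔⊎ (1↔⊤ ⊎-↔ ↔-refl)

Σ-Fin-zero↔ : ∀ {B : Fin 0 → Set} → Fin 0 ↔ Σ (Fin 0) B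
Σ-Fin-zero↔ = mk↔ₛ′ (λ ()) (λ ()) (λ ()) (λ ())

Σ-Fin-suc↔ : ∀ {n} {B : Fin (suc n) → Set} → (B Fin.zero ⊎ Σ (Fin n) (B ∘ Fin.suc)) ↔ Σ (Fin (suc n)) B
Σ-Fin-suc↔ = mk↔ₛ′
  (λ { (inj₁ b) → Fin.zero , b ; (inj₂ (i , b)) → Fin.suc i , b })
  (λ { (Fin.zero , b) → inj₁ b ; (Fin.suc i , b) → inj₂ (i , b) })
  (λ { (Fin.zero , b) → refl ; (Fin.suc i , b) → refl })
  (λ { (inj₁ b) → refl ; (inj₂ (i , b)) → refl })

finite-Σ-Fin : ∀ n {B : Fin n → Set} → (∀ i → Finite (B i)) → Finite (Σ (Fin n) B)
finite-Σ-Fin zero    _ = 0 , Σ-Fin-zero↔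
finite-Σ-Fin (suc n) h = finite-↔ (finite-⊎ (h Fin.zero) (finite-Σ-Fin n (h ∘ Fin.suc))) Σ-Fin-suc↔

finite-Σ : ∀ {A} {B : A → Set} → Finite A → (∀ a → Finite (B a)) → Finite (Σ A B)
finite-Σ (n , f) h = finite-↔ (finite-Σ-Fin n (h ∘ Inverse.to f)) (Σ.cong f ↔-refl)

Σ≤-suc↔ : ∀ {A : ℕ → Set} {m} →
  (A 0 ⊎ Σ ℕ λ j → j ≤ m × A (suc j)) ↔ (Σ ℕ λ j → j ≤ suc m × A j)
Σ≤-suc↔ = mk↔ₛ′
  (λ { (inj₁ a) → 0 , z≤n , a ; (inj₂ (j , j≤m , a)) → suc j , s≤s j≤m , a })
  (λ { (zero , _ , a) → inj₁ a ; (suc j , s≤s j≤m , a) → inj₂ (j , j≤m , a) })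
  (λ { (zero , z≤n , a) → refl ; (suc j , s≤s j≤m , a) → refl })
  (λ { (inj₁ a) → refl ; (inj₂ (j , j≤m , a)) → refl })

Σ≤-zero↔ : ∀ {A : ℕ → Set} → A 0 ↔ (Σ ℕ λ j → j ≤ 0 × A j)
Σ≤-zero↔ = mk↔ₛ′ (λ a → 0 , z≤n , a) (λ { (zero , z≤n , a) → a }) (λ { (zero , z≤n , a) → refl }) (λ _ → refl)

finite-Σ≤ : ∀ {A : ℕ → Set} → (∀ j → Finite (A j)) → ∀ m → Finite (Σ ℕ λ j → j ≤ m × A j)
finite-Σ≤ h zero    = finite-↔ (h 0) Σ≤-zero↔
finite-Σ≤ h (suc m) = finite-↔ (finite-⊎ (h 0) (finite-Σ≤ (h ∘ suc) m)) Σ≤-suc↔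

-- Induced cycles from a cyclic layout

Succ-functional : ∀ {L p q q′} → q < L → q′ < L → Succ L p q → Succ L p q′ → q ≡ q′
Succ-functional _   _    (inj₁ refl)     (inj₁ refl)     = refl
Succ-functional q<L _    (inj₁ refl)     (inj₂ (refl , _)) = ⊥-elim (<-irrefl refl q<L)
Succ-functional _   q′<L (inj₂ (refl , _)) (inj₁ refl)     = ⊥-elim (<-irrefl refl q′<L)
Succ-functional _   _    (inj₂ (_ , refl)) (inj₂ (_ , refl)) = refl

Succ-irreflexive : ∀ {L p} → L ≢ 1 → ¬ Succ L p p
Succ-irreflexive _   (inj₁ e)          = 1+n≢n e
Succ-irreflexive L≢1 (inj₂ (e , refl)) = L≢1 (sym e)

IsomorphicTerritory : ∀ {n} (G : Graph n) → InducedCycle G → {V : Set} → (V → V → Set) → (V → Set) → Set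
IsomorphicTerritory {n} G B {V} Ex InB = Σ (Fin n ⤖ V) λ f →
  (∀ u v → E G u v ⇔ Ex (Bijection.to f u) (Bijection.to f v))
  × (∀ v → InV B v ⇔ InB (Bijection.to f v))

record CyclicLayout {V : Set} (Ex : V → V → Set) (InB : V → Set) (ℓ : ℕ) : Set where
  field
    vertex          : Fin ℓ → V
    position        : V → ℕ
    position-vertex : ∀ i → position (vertex i) ≡ toℕ i
    vertex-on       : ∀ i → InB (vertex i)
    vertex-onto     : ∀ v → InB v → ∃ λ i → vertex i ≡ v
    successor       : ∀ v → InB v → ∃ λ y → InB y × Ex v y × Succ ℓ (position v) (position y)
    edge-adjacent   : ∀ {x y} → InB x → InB y → Ex x y → CycAdj ℓ (position x) (position y)

module _ {V : Set} {Ex : V → V → Set} {InB : V → Set} (Ex-sym : ∀ {x y} → Ex x y → Ex y x)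
         {ℓ} (layout : CyclicLayout Ex InB ℓ) where
  open CyclicLayout layout

  vertex-injective : ∀ i j → vertex i ≡ vertex j → i ≡ j
  vertex-injective i j e =
    toℕ-injective (trans (sym (position-vertex i)) (trans (cong position e) (position-vertex j)))

  succ-edge : ∀ i j → Succ ℓ (toℕ i) (toℕ j) → Ex (vertex i) (vertex j)
  succ-edge i j i→j with successor (vertex i) (vertex-on i)
  ... | y , y-on , edge , i→y with vertex-onto y y-on
  ... | k , refl = subst (Ex (vertex i) ∘ vertex) k≡j edge
    where
    k≡j : k ≡ j
    k≡j = toℕ-injective (Succ-functional (toℕ<n k) (toℕ<n j)
            (subst₂ (Succ ℓ) (position-vertex i) (position-vertex k) i→y) i→j)

  vertex-induced : ∀ i j → Ex (vertex i) (vertex j) ⇔ CycAdj ℓ (toℕ i) (toℕ j)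
  vertex-induced i j = mk⇔
    (subst₂ (CycAdj ℓ) (position-vertex i) (position-vertex j) ∘ edge-adjacent (vertex-on i) (vertex-on j))
    [ succ-edge i j , Ex-sym ∘ succ-edge j i ]

territory-from-layout : ∀ {V} {Ex : V → V → Set} {InB : V → Set} {ℓ} → CyclicLayout Ex InB ℓ →
  Finite V → (∀ {x y} → Ex x y → Ex y x) → (∀ x → ¬ Ex x x) → 3 ≤ ℓ →
  Σ ℕ λ n → Σ (Graph n) λ G → Σ (InducedCycle G) λ B → perimeter B ≡ ℓ × IsomorphicTerritory G B Ex InB
territory-from-layout {V} {Ex} {InB} {ℓ} layout (n , φ) Ex-sym Ex-irr ℓ≥3 =
  n , G , B , refl , ↔⇒⤖ φ , edges , on-B
  where
  open CyclicLayout layout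
  open Inverse φ

  G : Graph n
  G = record { E = λ a b → Ex (to a) (to b) ; E-sym = Ex-sym ; E-irr = λ {a} → Ex-irr (to a) }

  B : InducedCycle G
  B = record
    { len = ℓ ; len≥3 = ℓ≥3 ; vtx = from ∘ vertex
    ; vtx-inj = λ i j e → vertex-injective Ex-sym layout i j
                  (trans (sym (strictlyInverseˡ (vertex i))) (trans (cong to e) (strictlyInverseˡ (vertex j))))
    ; induced = λ i j → subst₂ (λ x y → Ex x y ⇔ CycAdj ℓ (toℕ i) (toℕ j))
                  (sym (strictlyInverseˡ (vertex i))) (sym (strictlyInverseˡ (vertex j)))
                  (vertex-induced Ex-sym layout i j) }

  edges : ∀ a b → E G a b ⇔ Ex (to a) (to b)
  edges a b = mk⇔ id id

  on-B : ∀ v → InV B v ⇔ InB (to v)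
  on-B v = mk⇔
    (λ { (i , refl) → subst InB (sym (strictlyInverseˡ (vertex i))) (vertex-on i) })
    (λ v-on → let i , e = vertex-onto (to v) v-on in i , trans (cong from e) (strictlyInverseʳ v))

-- Expansions and the territories (T_m, B_m)

module _ (t : ℕ) {V′ : Set} {E′ : V′ → V′ → Set} {L′ : ℕ} {c′ : Fin L′ → V′}
         (d : Expansion.Data t E′ L′ c′) where
  open Expansion t E′ L′ c′
  open Expansion.Data d

  expansion-irreflexive : (∀ x → ¬ E′ x x) → ∀ x → ¬ Ex d x x
  expansion-irreflexive E′-irr x = [ D-irr x , D-irr x ]
    where
    D-irr : ∀ x → ¬ D d x x
    D-irr (inj₁ x)                = E′-irr x
    D-irr (inj₂ (inj₁ _)) (_ , e) = 1+n≢n e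
    D-irr (inj₂ (inj₂ _)) (_ , e) = 1+n≢n e

  expansion-finite : Finite V′ → Finite (V d)
  expansion-finite V′-finite = finite-⊎ V′-finite (finite-⊎ (finite-× selected (finite-Fin _))
    (finite-× (finite-Σ selected (finite-T ∘ I)) (finite-Fin _)))
    where
    selected : Finite (Sel d)
    selected = finite-Σ (finite-Fin L′) (finite-T ∘ S)

Tm-finite : ∀ t m → Finite (TmV t m)
Tm-finite t m = finite-Σ≤ (finite-Fin ∘ Lm t) m

Tm-irreflexive : ∀ t m → 2 ≤ t → ∀ x → ¬ TmE t m x x
Tm-irreflexive t m 2≤t (j , j≤m , p) = [ irr , irr ]
  where
  irr : ¬ TmD t m (j , j≤m , p) (j , j≤m , p)
  irr (inj₁ (_ , s)) = Succ-irreflexive (λ L≡1 → <⇒≢ 2≤t (sym (m*n≡1⇒m≡1 t _ L≡1))) s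
  irr (inj₂ (e , _)) = 1+n≢n e

Bm-edge⇒adjacent : ∀ {t m p q} → TmE t m (Bm t m p) (Bm t m q) → CycAdj (Lm t m) (toℕ p) (toℕ q)
Bm-edge⇒adjacent (inj₁ (inj₁ (_ , s))) = inj₁ s
Bm-edge⇒adjacent (inj₂ (inj₁ (_ , s))) = inj₂ s
Bm-edge⇒adjacent (inj₁ (inj₂ (e , _))) = ⊥-elim (1+n≢n e)
Bm-edge⇒adjacent (inj₂ (inj₂ (e , _))) = ⊥-elim (1+n≢n e)

-- Arithmetic

bracket-increasing : (f : ℕ → ℕ) → (∀ m → f m < f (suc m)) →
  ∀ {k x} → f k ≤ x → ∃ λ m → k ≤ m × f m ≤ x × x < f (suc m)
bracket-increasing f f-inc {k} {x} fk≤x = go (suc x) k (s≤s (m≤m+n x (f k))) fk≤x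
  where
  go : ∀ fuel k → x < fuel + f k → f k ≤ x → ∃ λ m → k ≤ m × f m ≤ x × x < f (suc m)
  go zero       k x<fk  fk≤x = ⊥-elim (<⇒≱ x<fk fk≤x)
  go (suc fuel) k x<    fk≤x with f (suc k) ≤? x
  ... | no  fk+1≰x = k , ≤-refl , fk≤x , ≰⇒> fk+1≰x
  ... | yes fk+1≤x with go fuel (suc k) (≤-<-trans (≤-pred x<) (+-monoʳ-< fuel (f-inc k))) fk+1≤x
  ...   | m , k<m , fm≤x , x<fm+1 = m , ≤-trans (n≤1+n k) k<m , fm≤x , x<fm+1

⌊1+n+n/2⌋≡n : ∀ n → ⌊ suc (n + n) /2⌋ ≡ n
⌊1+n+n/2⌋≡n zero    = refl
⌊1+n+n/2⌋≡n (suc n) = cong suc (trans (cong ⌊_/2⌋ (+-suc n n)) (⌊1+n+n/2⌋≡n n))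

even-or-odd : ∀ n → n ≡ ⌊ n /2⌋ + ⌊ n /2⌋ ⊎ n ≡ suc (⌊ n /2⌋ + ⌊ n /2⌋)
even-or-odd zero          = inj₁ refl
even-or-odd (suc zero)    = inj₂ refl
even-or-odd (suc (suc n)) with even-or-odd n
... | inj₁ e = inj₁ (cong suc (trans (cong suc e) (sym (+-suc ⌊ n /2⌋ ⌊ n /2⌋))))
... | inj₂ e = inj₂ (cong suc (trans (cong suc e) (cong suc (sym (+-suc ⌊ n /2⌋ ⌊ n /2⌋)))))

n+n≢1+m+m : ∀ n m → n + n ≢ suc (m + m)
n+n≢1+m+m n m e =
  even≢odd n m (trans (cong (n +_) (+-identityʳ n)) (trans e (cong (suc ∘ (m +_)) (sym (+-identityʳ m)))))

module Arithmetic (w : ℕ) where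

  -- An expansion outside I adds 2u to the perimeter, one inside I adds b; bI and bN are the
  -- lengths of the blocks of the new cycle with and without a detour.
  t u b H bI bN : ℕ
  t  = 5 + w
  u  = 2 + w
  b  = 5 + 3 * w
  H  = u * (4 + 3 * w)
  bI = suc (u + (u + u))
  bN = suc (suc (u + u))

  L : ℕ → ℕ
  L = Lm t

  L-mono-< : ∀ m → L m < L (suc m)
  L-mono-< m = *-monoʳ-< t (^-monoʳ-< u (s≤s (s≤s z≤n)) (n<1+n m))

  L-mono-≤ : ∀ {m m′} → m ≤ m′ → L m ≤ L m′
  L-mono-≤ m≤m′ = *-monoʳ-≤ t (^-monoʳ-≤ u m≤m′)

  L-suc : ∀ m → L (suc m) ≡ u * L m
  L-suc m = x∙yz≈y∙xz *-commutativeSemigroup t u (u ^ m)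

  2∣L : ∀ m → 2 ∣ L (suc m)
  2∣L m = subst (2 ∣_) (*-assoc t u (u ^ m)) (∣m⇒∣m*n (u ^ m) (subst (2 ∣_) (*-comm u t) (2∣[2+n][5+n] w)))
    where
    2∣[2+n][5+n] : ∀ n → 2 ∣ (2 + n) * (5 + n)
    2∣[2+n][5+n] 0             = divides 5 refl
    2∣[2+n][5+n] 1             = divides 9 refl
    2∣[2+n][5+n] (suc (suc n)) = subst (2 ∣_) (step n) (∣m∣n⇒∣m+n (2∣[2+n][5+n] n) (n∣m*n (9 + 2 * n)))
      where
      step : ∀ n → (2 + n) * (5 + n) + (9 + 2 * n) * 2 ≡ (4 + n) * (7 + n)
      step = solve-∀

  -- Consecutive numbers are reached using 3u = b + 1 and (u − 1)b = (3u − 4)u + 1.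
  representable : ∀ q → ∃₂ λ M j → M ≤ 4 + 3 * w × H + q ≡ u * M + b * j
  representable zero = 4 + 3 * w , 0 , ≤-refl , base w
    where
    base : ∀ w → (2 + w) * (4 + 3 * w) + 0 ≡ (2 + w) * (4 + 3 * w) + (5 + 3 * w) * 0
    base = solve-∀
  representable (suc q) with representable q
  ... | M , j , M≤ , eq with M ≤? 1 + 3 * w
  ... | no M≰ = let (M′ , M≡) = m≤n⇒∃[o]m+o≡n (≰⇒> M≰) in
      M′ , j + suc w , ≤-trans (m≤n+m M′ _) (≤-trans (≤-reflexive M≡) M≤) ,
      (begin-equality
        H + suc q                                   ≡⟨ +-suc H q ⟩
        suc (H + q)                                 ≡⟨ cong suc eq ⟩
        suc (u * M + b * j)                         ≡⟨ cong (λ x → suc (u * x + b * j)) (sym M≡) ⟩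
        suc (u * (suc (suc (3 * w)) + M′) + b * j)  ≡⟨ trade-down w M′ j ⟩
        u * M′ + b * (j + suc w)                    ∎)
    where
    trade-down : ∀ w M j → suc ((2 + w) * (2 + 3 * w + M) + (5 + 3 * w) * j)
                         ≡ (2 + w) * M + (5 + 3 * w) * (j + suc w)
    trade-down = solve-∀
  ... | yes M≤1+3w with j
  ...   | suc j′ = 3 + M , j′ , +-monoʳ-≤ 3 M≤1+3w ,
      (begin-equality
        H + suc q                  ≡⟨ +-suc H q ⟩
        suc (H + q)                ≡⟨ cong suc eq ⟩
        suc (u * M + b * suc j′)   ≡⟨ trade-up w M j′ ⟩
        u * (3 + M) + b * j′       ∎)
    where
    trade-up : ∀ w M j → suc ((2 + w) * M + (5 + 3 * w) * suc j) ≡ (2 + w) * (3 + M) + (5 + 3 * w) * j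
    trade-up = solve-∀
  ...   | zero = ⊥-elim (<⇒≱ uM<H (begin
        H                 ≤⟨ m≤m+n H q ⟩
        H + q             ≡⟨ eq ⟩
        u * M + b * 0     ≡⟨ cong (u * M +_) (*-zeroʳ b) ⟩
        u * M + 0         ≡⟨ +-identityʳ (u * M) ⟩
        u * M             ∎))
    where
    uM<H : u * M < H
    uM<H = *-monoʳ-< u (<-≤-trans (s≤s M≤1+3w) (+-monoˡ-≤ (3 * w) (s≤s (s≤s (z≤n {2})))))

  first-scale : L 2 + 2 * H ≤ t ^ 3
  first-scale = subst (L 2 + 2 * H ≤_) (sym (cube w)) (m≤m+n _ _)
    where
    cube : ∀ w → (5 + w) * ((5 + w) * ((5 + w) * 1))
                 ≡ ((5 + w) * ((2 + w) * ((2 + w) * 1)) + 2 * ((2 + w) * (4 + 3 * w))) + (89 + 31 * w)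
    cube = solve-∀

  scale : ∀ {l} → t ^ 3 ≤ l → ∃ λ m → 2 ≤ m × L m + 2 * H ≤ l × l < u * L m + 2 * H
  scale {l} t³≤l =
    let m , 2≤m , low , high = bracket-increasing (λ m → L m + 2 * H) (λ m → +-monoˡ-< (2 * H) (L-mono-< m))
                                       (≤-trans first-scale t³≤l)
    in m , 2≤m , low , subst (λ x → l < x + 2 * H) (L-suc m) high

  excess : ∀ {m l} → 2 ≤ m → 2 ∣ l → L m + 2 * H ≤ l →
    ∃₂ λ M j → M ≤ 4 + 3 * w × l ≡ L m + 2 * (u * M + b * j)
  excess {m@(suc (suc m′))} {l} (s≤s (s≤s z≤n)) 2∣l low =
    let e , e≡            = m≤n⇒∃[o]m+o≡n low
        divides q e≡q*2   = ∣m+n∣m⇒∣n (subst (2 ∣_) (sym e≡) 2∣l) (∣m∣n⇒∣m+n (2∣L (suc m′)) (m∣m*n H))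
        M , j , M≤ , H+q≡ = representable q
    in M , j , M≤ , (begin-equality
        l                          ≡⟨ e≡ ⟨
        L m + 2 * H + e            ≡⟨ cong (L m + 2 * H +_) e≡q*2 ⟩
        L m + 2 * H + q * 2        ≡⟨ regroup (L m) H q ⟩
        L m + 2 * (H + q)          ≡⟨ cong (λ x → L m + 2 * x) H+q≡ ⟩
        L m + 2 * (u * M + b * j)  ∎)
    where
    regroup : ∀ x h q → x + 2 * h + q * 2 ≡ x + 2 * (h + q)
    regroup = solve-∀

  -- Multiplied by b, the claim reduces to 2(3u − 2)(3u − 1) < (u + 1)·L m, true from m = 2 on.
  expansions-fit : ∀ {m l M j} → 2 ≤ m → l < u * L m + 2 * H → l ≡ L m + 2 * (u * M + b * j) →
    M ≤ 4 + 3 * w → (j + j + M) + (j + j + M) < L m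
  expansions-fit {m} {l} {M} {j} 2≤m high l≡ M≤ =
    *-cancelˡ-< b _ _ (+-cancelʳ-< (2 * L m) _ _ (begin-strict
      b * ((j + j + M) + (j + j + M)) + 2 * L m           ≡⟨ expand w (L m) M j ⟩
      2 * (L m + 2 * (u * M + b * j)) + (2 + 2 * w) * M   ≡⟨ cong (λ x → 2 * x + (2 + 2 * w) * M) l≡ ⟨
      2 * l + (2 + 2 * w) * M                             <⟨ +-mono-<-≤ (*-monoʳ-< 2 high) (*-monoʳ-≤ (2 + 2 * w) M≤) ⟩
      2 * (u * L m + 2 * H) + (2 + 2 * w) * (4 + 3 * w)   ≡⟨ collect w (L m) ⟩
      2 * u * L m + 2 * (4 + 3 * w) * b                   <⟨ +-monoʳ-< (2 * u * L m) C<[1+u]L ⟩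
      2 * u * L m + (1 + u) * L m                         ≡⟨ regroup w (L m) ⟩
      b * L m + 2 * L m                                   ∎))
    where
    expand : ∀ w x M j → (5 + 3 * w) * ((j + j + M) + (j + j + M)) + 2 * x
                       ≡ 2 * (x + 2 * ((2 + w) * M + (5 + 3 * w) * j)) + (2 + 2 * w) * M
    expand = solve-∀
    collect : ∀ w x → 2 * ((2 + w) * x + 2 * ((2 + w) * (4 + 3 * w))) + (2 + 2 * w) * (4 + 3 * w)
                    ≡ 2 * (2 + w) * x + 2 * (4 + 3 * w) * (5 + 3 * w)
    collect = solve-∀
    regroup : ∀ w x → 2 * (2 + w) * x + (3 + w) * x ≡ (5 + 3 * w) * x + 2 * x
    regroup = solve-∀
    quartic : ∀ w → (3 + w) * ((5 + w) * ((2 + w) * ((2 + w) * 1)))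
                  ≡ suc (2 * (4 + 3 * w) * (5 + 3 * w) + (19 + 38 * w + 33 * w * w + 12 * w * w * w + w * w * w * w))
    quartic = solve-∀
    C<[1+u]L : 2 * (4 + 3 * w) * b < (1 + u) * L m
    C<[1+u]L = begin-strict
      2 * (4 + 3 * w) * b  <⟨ s≤s (m≤m+n _ _) ⟩
      _                    ≡⟨ quartic w ⟨
      (1 + u) * L 2        ≤⟨ *-monoʳ-≤ (1 + u) (L-mono-≤ 2≤m) ⟩
      (1 + u) * L m        ∎

  perimeter-decomposition : ∀ l → 2 ∣ l → t ^ 3 ≤ l → ∃ λ m → ∃ λ J → ∃ λ M → ∃ λ R →
    0 < R × (J + M) + (J + M) + R ≡ L m × J * bI + M * bN + R ≡ l
  perimeter-decomposition l 2∣l t³≤l =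
    let m , 2≤m , low , high = scale t³≤l
        M , j , M≤ , l≡      = excess 2≤m 2∣l low
        R′ , R≡              = m≤n⇒∃[o]m+o≡n {m = suc ((j + j + M) + (j + j + M))}
                                 (expansions-fit {M = M} {j = j} 2≤m high l≡ M≤)
        K+K+R≡L : (j + j + M) + (j + j + M) + suc R′ ≡ L m
        K+K+R≡L = trans (+-suc ((j + j + M) + (j + j + M)) R′) R≡
    in m , j + j , M , suc R′ , s≤s z≤n , K+K+R≡L , (begin-equality
      (j + j) * bI + M * bN + suc R′                               ≡⟨ split w j M (suc R′) ⟩
      ((j + j + M) + (j + j + M) + suc R′) + 2 * (u * M + b * j)   ≡⟨ cong (_+ 2 * (u * M + b * j)) K+K+R≡L ⟩
      L m + 2 * (u * M + b * j)                                    ≡⟨ l≡ ⟨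
      l                                                            ∎)
    where
    split : ∀ w j M R → (j + j) * suc ((2 + w) + ((2 + w) + (2 + w))) + M * suc (suc ((2 + w) + (2 + w))) + R
                      ≡ ((j + j + M) + (j + j + M) + R) + 2 * ((2 + w) * M + (5 + 3 * w) * j)
    split = solve-∀

-- The expanded territory

module Construction (w m J M R : ℕ) (R>0 : 0 < R) (K+K+R≡L : (J + M) + (J + M) + R ≡ Lm (5 + w) m) where
  open Arithmetic w using (t; u; bI; bN)

  K L newPerimeter : ℕ
  K = J + M
  L = Lm t m
  newPerimeter = J * bI + M * bN + R

  c′ : Fin L → TmV t m
  c′ = Bm t m

  Expanded : ℕ → Set
  Expanded p = p ≡ suc (⌊ p /2⌋ + ⌊ p /2⌋) × ⌊ p /2⌋ < K

  expanded? : ∀ p → Dec (Expanded p)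
  expanded? p = (p ≟ suc (⌊ p /2⌋ + ⌊ p /2⌋)) ×-dec (⌊ p /2⌋ <? K)

  odd-expanded : ∀ {r} → r < K → Expanded (suc (r + r))
  odd-expanded {r} r<K rewrite ⌊1+n+n/2⌋≡n r = refl , r<K

  even-unexpanded : ∀ r → ¬ Expanded (r + r)
  even-unexpanded r (e , _) = n+n≢1+m+m r ⌊ r + r /2⌋ e

  K≤⌊K+K+e/2⌋ : ∀ e → K ≤ ⌊ K + K + e /2⌋
  K≤⌊K+K+e/2⌋ e = ≤-trans (≤-reflexive (n≡⌊n+n/2⌋ K)) (⌊n/2⌋-mono (m≤m+n (K + K) e))

  tail-unexpanded : ∀ e → ¬ Expanded (K + K + e)
  tail-unexpanded e (_ , h<K) = <⇒≱ h<K (K≤⌊K+K+e/2⌋ e)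

  unexpanded-view : ∀ q → ¬ Expanded q → (∃ λ r → r < K × q ≡ r + r) ⊎ (∃ λ e → q ≡ K + K + e)
  unexpanded-view q q-kept with even-or-odd q | ⌊ q /2⌋ <? K
  ... | inj₁ q≡ | yes h<K = inj₁ (⌊ q /2⌋ , h<K , q≡)
  ... | inj₂ q≡ | yes h<K = contradiction (q≡ , h<K) q-kept
  ... | _       | no  h≮K = inj₂ (q ∸ (K + K) , sym (m+[n∸m]≡n K+K≤q))
    where
    K+K≤q : K + K ≤ q
    K+K≤q = begin
      K + K                   ≤⟨ +-mono-≤ (≮⇒≥ h≮K) (≮⇒≥ h≮K) ⟩
      ⌊ q /2⌋ + ⌊ q /2⌋       ≤⟨ +-monoʳ-≤ ⌊ q /2⌋ (⌊n/2⌋≤⌈n/2⌉ q) ⟩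
      ⌊ q /2⌋ + ⌈ q /2⌉       ≡⟨ ⌊n/2⌋+⌈n/2⌉≡n q ⟩
      q                       ∎

  1+r+r<K+K : ∀ {r} → r < K → suc (r + r) < K + K
  1+r+r<K+K {r} r<K = ≤-trans (≤-reflexive (cong suc (sym (+-suc r r)))) (+-mono-≤ r<K r<K)

  K+K<L : K + K < L
  K+K<L = subst (K + K <_) K+K+R≡L (m<m+n (K + K) R>0)

  Expanded⇒<K+K : ∀ {p} → Expanded p → p < K + K
  Expanded⇒<K+K (p≡ , h<K) = subst (_< K + K) (sym p≡) (1+r+r<K+K h<K)

  expanded-apart : ∀ {p q} → Expanded p → Expanded q → ¬ CycAdj L p q
  expanded-apart p-exp q-exp = [ apart p-exp q-exp , apart q-exp p-exp ]
    where
    apart : ∀ {p q} → Expanded p → Expanded q → ¬ Succ L p q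
    apart {p} {q} (p≡ , _) (q≡ , _) (inj₁ 1+p≡q) =
      n+n≢1+m+m (suc ⌊ p /2⌋) ⌊ q /2⌋
        (trans (cong suc (+-suc ⌊ p /2⌋ ⌊ p /2⌋)) (trans (cong suc (sym p≡)) (trans 1+p≡q q≡)))
    apart _ (q≡ , _) (inj₂ (_ , q≡0)) = 0≢1+n (trans (sym q≡0) q≡)

  selection : Expansion.Data t (TmE t m) L c′
  selection = record
    { S      = λ q → isYes (expanded? (toℕ q))
    ; stable = λ p q p-exp q-exp → expanded-apart (toWitness p-exp) (toWitness q-exp)
    ; I      = λ s → isYes (⌊ toℕ (proj₁ s) /2⌋ <? J)
    }

  open Expansion t (TmE t m) L c′
  open Expansion.Data selection using (S; I)

  -- Block r < K of the new cycle is the kept vertex 2r followed by the path replacing vertex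
  -- 2r + 1, the detour Q (for r < J) coming between the two halves of P; the kept vertices
  -- 2K, …, L − 1 follow the last block.
  blockStart : ℕ → ℕ
  blockStart r = bI * (r ⊓ J) + bN * (r ∸ J)

  -- Proofs split on J ≤? r rather than r <? J: a with-abstraction of r <? J would also rewrite
  -- the test inside pathOffset.
  pathOffset : ℕ → ℕ → ℕ
  pathOffset r a with r <? J | u <? a
  ... | yes _ | yes _ = u + a
  ... | _     | _     = suc a

  pathPosition detourPosition : ℕ → ℕ → ℕ
  pathPosition r a   = blockStart r + pathOffset r a
  detourPosition r b = blockStart r + suc (u + b)

  keptPosition : ℕ → ℕ
  keptPosition q = blockStart (⌊ q /2⌋ ⊓ K) + (q ∸ (K + K))

  pathOffset-I : ∀ {r a} → r < J → u < a → pathOffset r a ≡ u + a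
  pathOffset-I {r} {a} r<J u<a with r <? J | u <? a
  ... | yes _ | yes _   = refl
  ... | no r≮J | _      = contradiction r<J r≮J
  ... | yes _ | no u≮a  = contradiction u<a u≮a

  pathOffset-plain : ∀ {r a} → ¬ (r < J × u < a) → pathOffset r a ≡ suc a
  pathOffset-plain {r} {a} ¬I with r <? J | u <? a
  ... | yes r<J | yes u<a = contradiction (r<J , u<a) ¬I
  ... | yes _   | no _    = refl
  ... | no _    | _       = refl

  pathOffset-zero : ∀ r → pathOffset r 0 ≡ 1
  pathOffset-zero r = pathOffset-plain (λ ())

  pathOffset-suc : ∀ {r a} → (r < J → a ≢ u) → (r < J → suc a ≢ u) → suc (pathOffset r a) ≡ pathOffset r (suc a)
  pathOffset-suc {r} {a} a-on a+1-on with J ≤? r | a <? u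
  ... | yes J≤r | _ = trans (cong suc (pathOffset-plain (N ∘ proj₁))) (sym (pathOffset-plain (N ∘ proj₁)))
    where
    N : ¬ r < J
    N = ≤⇒≯ J≤r
  ... | no J≰r | yes a<u =
    trans (cong suc (pathOffset-plain (<-asym a<u ∘ proj₂))) (sym (pathOffset-plain (<-asym 1+a<u ∘ proj₂)))
    where
    1+a<u : suc a < u
    1+a<u = ≤∧≢⇒< a<u (a+1-on (≰⇒> J≰r))
  ... | no J≰r | no a≮u = trans (cong suc (pathOffset-I (≰⇒> J≰r) u<a))
    (trans (sym (+-suc u a)) (sym (pathOffset-I (≰⇒> J≰r) (<-trans u<a (n<1+n a)))))
    where
    u<a : u < a
    u<a = ≤∧≢⇒< (≮⇒≥ a≮u) (a-on (≰⇒> J≰r) ∘ sym)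

  blockStart-I : ∀ {r} → r ≤ J → blockStart r ≡ bI * r
  blockStart-I {r} r≤J rewrite m≤n⇒m⊓n≡m r≤J | m≤n⇒m∸n≡0 r≤J | *-zeroʳ bN = +-identityʳ (bI * r)

  blockStart-N : ∀ r → blockStart (J + r) ≡ J * bI + bN * r
  blockStart-N r rewrite m≥n⇒m⊓n≡n (m≤m+n J r) | m+n∸m≡n J r = cong (_+ bN * r) (*-comm bI J)

  blockStart-K : blockStart K ≡ J * bI + M * bN
  blockStart-K = trans (blockStart-N M) (cong (J * bI +_) (*-comm bN M))

  blockStart-suc-I : ∀ {r} → r < J → blockStart (suc r) ≡ blockStart r + bI
  blockStart-suc-I {r} r<J = begin-equality
    blockStart (suc r)  ≡⟨ blockStart-I r<J ⟩
    bI * suc r          ≡⟨ trans (*-suc bI r) (+-comm bI (bI * r)) ⟩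
    bI * r + bI         ≡⟨ cong (_+ bI) (blockStart-I (<⇒≤ r<J)) ⟨
    blockStart r + bI   ∎

  blockStart-suc-N : ∀ {r} → J ≤ r → blockStart (suc r) ≡ blockStart r + bN
  blockStart-suc-N J≤r with m≤n⇒∃[o]m+o≡n J≤r
  ... | r′ , refl = begin-equality
    blockStart (suc (J + r′))  ≡⟨ cong blockStart (+-suc J r′) ⟨
    blockStart (J + suc r′)    ≡⟨ blockStart-N (suc r′) ⟩
    J * bI + bN * suc r′       ≡⟨ cong (J * bI +_) (trans (*-suc bN r′) (+-comm bN (bN * r′))) ⟩
    J * bI + (bN * r′ + bN)    ≡⟨ +-assoc (J * bI) _ _ ⟨
    J * bI + bN * r′ + bN      ≡⟨ cong (_+ bN) (blockStart-N r′) ⟨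
    blockStart (J + r′) + bN   ∎

  block-end : ∀ r → suc (pathPosition r (u + u)) ≡ blockStart (suc r)
  block-end r with J ≤? r
  ... | no J≰r  = trans (cong (suc ∘ (blockStart r +_)) (pathOffset-I (≰⇒> J≰r) (m<m+n u 0<1+n)))
                        (trans (sym (+-suc (blockStart r) _)) (sym (blockStart-suc-I (≰⇒> J≰r))))
  ... | yes J≤r = trans (cong (suc ∘ (blockStart r +_)) (pathOffset-plain (≤⇒≯ J≤r ∘ proj₁)))
                        (trans (sym (+-suc (blockStart r) _)) (sym (blockStart-suc-N J≤r)))

  keptPosition-even : ∀ {r} → r ≤ K → keptPosition (r + r) ≡ blockStart r
  keptPosition-even {r} r≤K rewrite sym (n≡⌊n+n/2⌋ r) | m≤n⇒m⊓n≡m r≤K | m≤n⇒m∸n≡0 (+-mono-≤ r≤K r≤K) =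
    +-identityʳ (blockStart r)

  keptPosition-tail : ∀ e → keptPosition (K + K + e) ≡ blockStart K + e
  keptPosition-tail e rewrite m≥n⇒m⊓n≡n (K≤⌊K+K+e/2⌋ e) | m+n∸m≡n (K + K) e = refl

  keptPosition-zero : keptPosition 0 ≡ 0
  keptPosition-zero = trans (keptPosition-even z≤n) (trans (blockStart-I z≤n) (*-zeroʳ bI))

  block : Fin L → ℕ
  block p = ⌊ toℕ p /2⌋

  position : V selection → ℕ
  position (inj₁ (_ , _ , q))                = keptPosition (toℕ q)
  position (inj₂ (inj₁ ((p , _) , a)))       = pathPosition (block p) (toℕ a)
  position (inj₂ (inj₂ (((p , _) , _) , b))) = detourPosition (block p) (toℕ b)

  NP≡ : 2 * t ∸ 5 ≡ suc (u + u)
  NP≡ = lemma w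
    where
    lemma : ∀ w → w + (5 + w + 0) ≡ suc ((2 + w) + (2 + w))
    lemma = solve-∀

  2u≡ : 2 * t ∸ 6 ≡ u + u
  2u≡ = trans (sym (∸-+-assoc (2 * t) 5 1)) (cong (_∸ 1) NP≡)

  1+r+r<L : ∀ {r} → r < K → suc (r + r) < L
  1+r+r<L r<K = <-trans (1+r+r<K+K r<K) K+K<L

  r+r<L : ∀ {r} → r < K → r + r < L
  r+r<L r<K = <-trans (+-mono-< r<K r<K) K+K<L

  J+r<K : (r : Fin M) → J + toℕ r < K
  J+r<K r = +-monoʳ-< J (toℕ<n r)

  tail<L : (e : Fin R) → K + K + toℕ e < L
  tail<L e = subst (K + K + toℕ e <_) K+K+R≡L (+-monoʳ-< (K + K) (toℕ<n e))

  Fin-u<1+2u : (a : Fin u) → toℕ a < suc (u + u)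
  Fin-u<1+2u a = ≤-trans (toℕ<n a) (≤-trans (m≤m+n u u) (n≤1+n _))

  return<1+2u : (a : Fin u) → suc (u + toℕ a) < suc (u + u)
  return<1+2u a = s≤s (+-monoʳ-< u (toℕ<n a))

  <J⇒<K : ∀ {r} → r < J → r < K
  <J⇒<K r<J = <-≤-trans r<J (m≤m+n J M)

  kept : ∀ q → q < L → V selection
  kept q q<L = inj₁ (c′ (fromℕ< q<L))

  expandedAt : ∀ {r} → r < K → Sel selection
  expandedAt r<K =
    fromℕ< (1+r+r<L r<K) , fromWitness (subst Expanded (sym (toℕ-fromℕ< (1+r+r<L r<K))) (odd-expanded r<K))

  half-expandedAt : ∀ {r} (r<K : r < K) → ⌊ toℕ (proj₁ (expandedAt r<K)) /2⌋ ≡ r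
  half-expandedAt {r} r<K = trans (cong ⌊_/2⌋ (toℕ-fromℕ< (1+r+r<L r<K))) (⌊1+n+n/2⌋≡n r)

  pathIndex : ∀ {a} → a < suc (u + u) → Fin (2 * t ∸ 5)
  pathIndex {a} a<1+2u = fromℕ< (subst (a <_) (sym NP≡) a<1+2u)

  toℕ-pathIndex : ∀ {a} (a<1+2u : a < suc (u + u)) → toℕ (pathIndex a<1+2u) ≡ a
  toℕ-pathIndex {a} a<1+2u = toℕ-fromℕ< (subst (a <_) (sym NP≡) a<1+2u)

  path : ∀ {r} → r < K → ∀ {a} → a < suc (u + u) → V selection
  path r<K a<1+2u = inj₂ (inj₁ (expandedAt r<K , pathIndex a<1+2u))

  expandedAt-I : ∀ {r} (r<J : r < J) → T (I (expandedAt (<J⇒<K r<J)))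
  expandedAt-I r<J = fromWitness (subst (_< J) (sym (half-expandedAt (<J⇒<K r<J))) r<J)

  detour : ∀ {r} → r < J → Fin u → V selection
  detour r<J b = inj₂ (inj₂ ((expandedAt (<J⇒<K r<J) , expandedAt-I r<J) , b))

  position-kept : ∀ {q} (q<L : q < L) → position (kept q q<L) ≡ keptPosition q
  position-kept q<L = cong keptPosition (toℕ-fromℕ< q<L)

  position-path : ∀ {r} (r<K : r < K) {a} (a<1+2u : a < suc (u + u)) →
    position (path r<K a<1+2u) ≡ pathPosition r a
  position-path r<K a<1+2u rewrite half-expandedAt r<K | toℕ-pathIndex a<1+2u = refl

  position-detour : ∀ {r} (r<J : r < J) b → position (detour r<J b) ≡ detourPosition r (toℕ b)
  position-detour r<J b rewrite half-expandedAt (<J⇒<K r<J) = refl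

  kept-on : ∀ {q} (q<L : q < L) → ¬ Expanded q → InB selection (kept q q<L)
  kept-on q<L q-kept = fromℕ< q<L , q-kept ∘ subst Expanded (toℕ-fromℕ< q<L) ∘ toWitness , refl

  path-on : ∀ {r} (r<K : r < K) {a} (a<1+2u : a < suc (u + u)) → (r < J → a ≢ u) →
    InB selection (path r<K a<1+2u)
  path-on r<K a<1+2u a-on in-I a≡u =
    a-on (subst (_< J) (half-expandedAt r<K) (toWitness in-I))
         (trans (sym (toℕ-pathIndex a<1+2u)) a≡u)

  Sel-≡ : ∀ {p p′ : Fin L} {p-exp p′-exp} → toℕ p ≡ toℕ p′ → (Sel selection ∋ (p , p-exp)) ≡ (p′ , p′-exp)
  Sel-≡ {p-exp = p-exp} {p′-exp} e with toℕ-injective e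
  ... | refl = cong (_ ,_) (T-irrelevant p-exp p′-exp)

  kept-≡ : ∀ {q′} (q′<L : q′ < L) {q} → q′ ≡ toℕ q → kept q′ q′<L ≡ inj₁ (c′ q)
  kept-≡ q′<L e = cong (inj₁ ∘ c′) (toℕ-injective (trans (toℕ-fromℕ< q′<L) e))

  path-≡ : ∀ {r} (r<K : r < K) {a′} (a′<1+2u : a′ < suc (u + u)) {p p-exp a} →
    suc (r + r) ≡ toℕ p → a′ ≡ toℕ a → path r<K a′<1+2u ≡ inj₂ (inj₁ ((p , p-exp) , a))
  path-≡ r<K a′<1+2u p≡ a≡ = cong (inj₂ ∘ inj₁) (cong₂ _,_
    (Sel-≡ (trans (toℕ-fromℕ< (1+r+r<L r<K)) p≡))
    (toℕ-injective (trans (toℕ-pathIndex a′<1+2u) a≡)))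

  detour-≡ : ∀ {r} (r<J : r < J) b {p p-exp in-I} → suc (r + r) ≡ toℕ p →
    detour r<J b ≡ inj₂ (inj₂ (((p , p-exp) , in-I) , b))
  detour-≡ r<J b {p-exp = p-exp} {in-I} p≡ with toℕ-injective (trans (toℕ-fromℕ< (1+r+r<L (<J⇒<K r<J))) p≡)
  ... | refl with T-irrelevant (proj₂ (expandedAt (<J⇒<K r<J))) p-exp
  ... | refl with T-irrelevant (expandedAt-I r<J) in-I
  ... | refl = refl

  enter-block : ∀ {r} → r < K → suc (keptPosition (r + r)) ≡ pathPosition r 0
  enter-block {r} r<K = begin-equality
    suc (keptPosition (r + r))  ≡⟨ cong suc (keptPosition-even (<⇒≤ r<K)) ⟩
    suc (blockStart r)          ≡⟨ +-comm 1 (blockStart r) ⟩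
    blockStart r + 1            ≡⟨ cong (blockStart r +_) (pathOffset-zero r) ⟨
    pathPosition r 0            ∎

  path-step : ∀ {r a} → (r < J → a ≢ u) → (r < J → suc a ≢ u) → suc (pathPosition r a) ≡ pathPosition r (suc a)
  path-step {r} {a} a-on a+1-on =
    trans (sym (+-suc (blockStart r) (pathOffset r a))) (cong (blockStart r +_) (pathOffset-suc a-on a+1-on))

  enter-detour : ∀ r → suc (pathPosition r (suc w)) ≡ detourPosition r 0
  enter-detour r = begin-equality
    suc (blockStart r + pathOffset r (suc w))
      ≡⟨ cong (suc ∘ (blockStart r +_)) (pathOffset-plain (≤⇒≯ (n≤1+n (suc w)) ∘ proj₂)) ⟩
    suc (blockStart r + u)                    ≡⟨ +-suc (blockStart r) u ⟨
    blockStart r + suc u                      ≡⟨ cong (λ x → blockStart r + suc x) (+-identityʳ u) ⟨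
    detourPosition r 0                        ∎

  detour-step : ∀ r b → suc (detourPosition r b) ≡ detourPosition r (suc b)
  detour-step r b = trans (sym (+-suc (blockStart r) _)) (cong (λ x → blockStart r + suc x) (sym (+-suc u b)))

  leave-detour : ∀ {r} → r < J → suc (detourPosition r (suc w)) ≡ pathPosition r (suc u)
  leave-detour {r} r<J = begin-equality
    suc (blockStart r + suc (u + suc w)) ≡⟨ +-suc (blockStart r) _ ⟨
    blockStart r + suc (suc (u + suc w)) ≡⟨ cong (λ x → blockStart r + suc x) (+-suc u (suc w)) ⟨
    blockStart r + suc (u + u)           ≡⟨ cong (blockStart r +_) (+-suc u u) ⟨
    blockStart r + (u + suc u)           ≡⟨ cong (blockStart r +_) (pathOffset-I r<J (n<1+n u)) ⟨
    pathPosition r (suc u)               ∎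

  leave-block : ∀ {r} → r < K → suc (pathPosition r (u + u)) ≡ keptPosition (suc r + suc r)
  leave-block {r} r<K = trans (block-end r) (sym (keptPosition-even r<K))

  tail-step : ∀ e → suc (keptPosition (K + K + e)) ≡ keptPosition (suc (K + K + e))
  tail-step e = begin-equality
    suc (keptPosition (K + K + e))  ≡⟨ cong suc (keptPosition-tail e) ⟩
    suc (blockStart K + e)          ≡⟨ +-suc (blockStart K) e ⟨
    blockStart K + suc e            ≡⟨ keptPosition-tail (suc e) ⟨
    keptPosition (K + K + suc e)    ≡⟨ cong keptPosition (+-suc (K + K) e) ⟩
    keptPosition (suc (K + K + e))  ∎

  tail-wrap : ∀ {e} → suc (K + K + e) ≡ L → suc (keptPosition (K + K + e)) ≡ newPerimeter
  tail-wrap {e} last = begin-equality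
    suc (keptPosition (K + K + e))  ≡⟨ tail-step e ⟩
    keptPosition (suc (K + K + e))  ≡⟨ cong keptPosition (trans last (sym K+K+R≡L)) ⟩
    keptPosition (K + K + R)        ≡⟨ keptPosition-tail R ⟩
    blockStart K + R                ≡⟨ cong (_+ R) blockStart-K ⟩
    newPerimeter                    ∎

  kept-succ : ∀ {q q′} → ¬ Expanded q → ¬ Expanded q′ → Succ L q q′ →
    Succ newPerimeter (keptPosition q) (keptPosition q′)
  kept-succ {q} q-kept q′-kept (inj₁ refl) with unexpanded-view q q-kept
  ... | inj₁ (r , r<K , refl) = contradiction (odd-expanded r<K) q′-kept
  ... | inj₂ (e , refl)       = inj₁ (tail-step e)
  kept-succ {q} q-kept _ (inj₂ (last , refl)) with unexpanded-view q q-kept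
  ... | inj₁ (r , r<K , refl) = contradiction last (<⇒≢ (1+r+r<L r<K))
  ... | inj₂ (e , refl)       = inj₂ (tail-wrap last , keptPosition-zero)

  kept-path-adjacent : ∀ q p p-exp a → ¬ T (S q) → D selection (inj₁ (c′ q)) (inj₂ (inj₁ ((p , p-exp) , a))) →
    CycAdj newPerimeter (keptPosition (toℕ q)) (pathPosition (block p) (toℕ a))
  kept-path-adjacent q p p-exp a _ (inj₁ (a≡0 , _ , q→p , refl)) with toWitness p-exp | q→p
  ... | p≡ , h<K | inj₁ 1+q≡p = inj₁ (inj₁ (begin-equality
    suc (keptPosition (toℕ q))              ≡⟨ cong (suc ∘ keptPosition) (suc-injective (trans 1+q≡p p≡)) ⟩
    suc (keptPosition (block p + block p))  ≡⟨ enter-block h<K ⟩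
    pathPosition (block p) 0                ≡⟨ cong (pathPosition (block p)) a≡0 ⟨
    pathPosition (block p) (toℕ a)          ∎))
  ... | p≡ , _ | inj₂ (_ , p≡0) = contradiction (trans (sym p≡0) p≡) 0≢1+n
  kept-path-adjacent q p p-exp a q-kept (inj₂ (inj₁ (_ , refl))) = contradiction p-exp q-kept
  kept-path-adjacent q p p-exp a _ (inj₂ (inj₂ (a≡2u , _ , p→q , refl))) with toWitness p-exp | p→q
  ... | p≡ , h<K | inj₁ 1+p≡q = inj₂ (inj₁ (begin-equality
    suc (pathPosition (block p) (toℕ a))          ≡⟨ cong (suc ∘ pathPosition (block p)) (trans a≡2u 2u≡) ⟩
    suc (pathPosition (block p) (u + u))          ≡⟨ leave-block h<K ⟩
    keptPosition (suc (block p) + suc (block p))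
      ≡⟨ cong keptPosition (trans (cong suc (+-suc _ _)) (trans (cong suc (sym p≡)) 1+p≡q)) ⟩
    keptPosition (toℕ q)                          ∎))
  ... | p-expanded | inj₂ (last , _) = contradiction last (<⇒≢ (≤-<-trans (Expanded⇒<K+K p-expanded) K+K<L))

  adjacent : ∀ {x y} → InB selection x → InB selection y → D selection x y →
    CycAdj newPerimeter (position x) (position y)
  adjacent {inj₁ _} {inj₁ _} (q , q-kept , refl) (q′ , q′-kept , refl) q~q′ =
    Sum.map (kept-succ (q-kept ∘ fromWitness) (q′-kept ∘ fromWitness))
            (kept-succ (q′-kept ∘ fromWitness) (q-kept ∘ fromWitness)) (Bm-edge⇒adjacent q~q′)
  adjacent {inj₁ _} {inj₂ (inj₁ ((p , p-exp) , a))} (q , q-kept , refl) _ q~p =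
    kept-path-adjacent q p p-exp a q-kept q~p
  adjacent {inj₂ (inj₁ ((p , _) , a))} {inj₂ (inj₁ (_ , b))} a-on b-on (refl , a→b) =
    inj₁ (inj₁ (trans (path-step (a-on ∘ fromWitness) (λ h<J → b-on (fromWitness h<J) ∘ trans (sym a→b)))
                      (cong (pathPosition (block p)) a→b)))
  adjacent {inj₂ (inj₁ ((p , _) , a))} {inj₂ (inj₂ (_ , b))} _ _ (refl , inj₁ (a≡ , b≡)) =
    inj₁ (inj₁ (subst₂ (λ a b → suc (pathPosition (block p) a) ≡ detourPosition (block p) b)
                       (sym a≡) (sym b≡) (enter-detour (block p))))
  adjacent {inj₂ (inj₁ ((p , _) , a))} {inj₂ (inj₂ ((_ , in-I) , b))} _ _ (refl , inj₂ (a≡ , b≡)) =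
    inj₂ (inj₁ (subst₂ (λ a b → suc (detourPosition (block p) b) ≡ pathPosition (block p) a)
                       (sym a≡) (sym b≡) (leave-detour (toWitness in-I))))
  adjacent {inj₂ (inj₂ (((p , _) , _) , b))} {inj₂ (inj₂ (_ , b′))} _ _ (refl , b→b′) =
    inj₁ (inj₁ (trans (detour-step (block p) (toℕ b)) (cong (detourPosition (block p)) b→b′)))

  Successor : V selection → Set
  Successor v = ∃ λ y → InB selection y × Ex selection v y × Succ newPerimeter (position v) (position y)

  kept-successor : ∀ q → ¬ Expanded (toℕ q) → Successor (inj₁ (c′ q))
  kept-successor q q-kept with unexpanded-view (toℕ q) q-kept
  ... | inj₁ (r , r<K , q≡) =
    path r<K 0<1+n , path-on r<K 0<1+n (λ _ → 0≢1+n) ,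
    inj₁ (inj₁ (toℕ-pathIndex 0<1+n , q , inj₁ (trans (cong suc q≡) (sym (toℕ-fromℕ< (1+r+r<L r<K)))) , refl)) ,
    inj₁ (trans (cong (suc ∘ keptPosition) q≡) (trans (enter-block r<K) (sym (position-path r<K 0<1+n))))
  ... | inj₂ (e , q≡) with m≤n⇒m<n∨m≡n (toℕ<n q)
  ...   | inj₁ 1+q<L =
    kept _ 1+q<L , kept-on 1+q<L (tail-unexpanded (suc e) ∘ subst Expanded 1+q≡) ,
    inj₁ (inj₁ (inj₁ (refl , inj₁ (sym (toℕ-fromℕ< 1+q<L))))) ,
    inj₁ (trans (cong (suc ∘ keptPosition) q≡)
                (trans (tail-step e) (cong keptPosition (sym (trans (toℕ-fromℕ< 1+q<L) (cong suc q≡))))))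
    where
    1+q≡ : suc (toℕ q) ≡ K + K + suc e
    1+q≡ = trans (cong suc q≡) (sym (+-suc (K + K) e))
  ...   | inj₂ last =
    kept 0 0<L , kept-on 0<L (even-unexpanded 0) ,
    inj₁ (inj₁ (inj₁ (refl , inj₂ (last , toℕ-fromℕ< 0<L)))) ,
    inj₂ (trans (cong (suc ∘ keptPosition) q≡) (tail-wrap (trans (cong suc (sym q≡)) last)) ,
          trans (position-kept 0<L) keptPosition-zero)
    where
    0<L : 0 < L
    0<L = ≤-<-trans z≤n K+K<L

  along-path : ∀ p p-exp a → (T (I (p , p-exp)) → toℕ a ≢ u) → (1+a<NP : suc (toℕ a) < 2 * t ∸ 5) →
    (block p < J → suc (toℕ a) ≢ u) → Successor (inj₂ (inj₁ ((p , p-exp) , a)))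
  along-path p p-exp a a-on 1+a<NP a+1-on =
    inj₂ (inj₁ ((p , p-exp) , fromℕ< 1+a<NP)) ,
    (λ in-I → a+1-on (toWitness in-I) ∘ trans (sym (toℕ-fromℕ< 1+a<NP))) ,
    inj₁ (refl , sym (toℕ-fromℕ< 1+a<NP)) ,
    inj₁ (trans (path-step (a-on ∘ fromWitness) a+1-on)
                (cong (pathPosition (block p)) (sym (toℕ-fromℕ< 1+a<NP))))

  path-successor : ∀ p p-exp a → (T (I (p , p-exp)) → toℕ a ≢ u) → Successor (inj₂ (inj₁ ((p , p-exp) , a)))
  path-successor p p-exp a a-on with toWitness p-exp | m≤n⇒m<n∨m≡n (toℕ<n a)
  ... | p≡ , h<K | inj₂ last =
    kept _ next<L , kept-on next<L (even-unexpanded (suc (block p))) ,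
    inj₂ (inj₂ (inj₂ (trans a≡2u (sym 2u≡) , fromℕ< next<L ,
      inj₁ (trans (cong suc (trans p≡ (sym (+-suc (block p) (block p))))) (sym (toℕ-fromℕ< next<L))) , refl))) ,
    inj₁ (trans (cong (suc ∘ pathPosition (block p)) a≡2u)
                (trans (leave-block h<K) (sym (position-kept next<L))))
    where
    a≡2u : toℕ a ≡ u + u
    a≡2u = suc-injective (trans last NP≡)
    next<L : suc (block p) + suc (block p) < L
    next<L = ≤-<-trans (+-mono-≤ h<K h<K) K+K<L
  ... | _ | inj₁ 1+a<NP with J ≤? block p | suc (toℕ a) ≟ u
  ...   | no J≰h | yes 1+a≡u =
    inj₂ (inj₂ (((p , p-exp) , fromWitness (≰⇒> J≰h)) , Fin.zero)) , _ ,
    inj₁ (refl , inj₁ (suc-injective 1+a≡u , refl)) ,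
    inj₁ (trans (cong (suc ∘ pathPosition (block p)) (suc-injective 1+a≡u)) (enter-detour (block p)))
  ...   | yes J≤h | _        = along-path p p-exp a a-on 1+a<NP (λ h<J → contradiction h<J (≤⇒≯ J≤h))
  ...   | no _    | no 1+a≢u = along-path p p-exp a a-on 1+a<NP (λ _ → 1+a≢u)

  detour-successor : ∀ p p-exp in-I b → Successor (inj₂ (inj₂ (((p , p-exp) , in-I) , b)))
  detour-successor p p-exp in-I b with m≤n⇒m<n∨m≡n (toℕ<n b)
  ... | inj₁ 1+b<u =
    inj₂ (inj₂ (((p , p-exp) , in-I) , fromℕ< 1+b<u)) , _ ,
    inj₁ (refl , sym (toℕ-fromℕ< 1+b<u)) ,
    inj₁ (trans (detour-step (block p) (toℕ b)) (cong (detourPosition (block p)) (sym (toℕ-fromℕ< 1+b<u))))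
  ... | inj₂ last =
    inj₂ (inj₁ ((p , p-exp) , pathIndex 1+u<1+2u)) ,
    (λ _ → 1+n≢n ∘ trans (sym (toℕ-pathIndex 1+u<1+2u))) ,
    inj₂ (refl , inj₂ (toℕ-pathIndex 1+u<1+2u , suc-injective last)) ,
    inj₁ (subst₂ (λ a b → suc (detourPosition (block p) b) ≡ pathPosition (block p) a)
                 (sym (toℕ-pathIndex 1+u<1+2u)) (sym (suc-injective last)) (leave-detour (toWitness in-I)))
    where
    1+u<1+2u : suc u < suc (u + u)
    1+u<1+2u = s≤s (m<m+n u 0<1+n)

  successor : ∀ v → InB selection v → Successor v
  successor (inj₁ _) (q , q-kept , refl)                = kept-successor q (q-kept ∘ fromWitness)
  successor (inj₂ (inj₁ ((p , p-exp) , a))) a-on        = path-successor p p-exp a a-on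
  successor (inj₂ (inj₂ (((p , p-exp) , in-I) , b))) _  = detour-successor p p-exp in-I b

  -- Fin newPerimeter splits into J blocks with a detour, M blocks without one and R tail vertices.
  Offset-I Offset-N Location : Set
  Offset-I = ⊤ ⊎ (Fin u ⊎ (Fin u ⊎ Fin u))
  Offset-N = ⊤ ⊎ Fin (suc (u + u))
  Location = ((Fin J × Offset-I) ⊎ (Fin M × Offset-N)) ⊎ Fin R

  pattern I-kept r     = inj₁ (inj₁ (r , inj₁ tt))
  pattern I-path r a   = inj₁ (inj₁ (r , inj₂ (inj₁ a)))
  pattern I-detour r b = inj₁ (inj₁ (r , inj₂ (inj₂ (inj₁ b))))
  pattern I-return r a = inj₁ (inj₁ (r , inj₂ (inj₂ (inj₂ a))))
  pattern N-kept r     = inj₁ (inj₂ (r , inj₁ tt))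
  pattern N-path r a   = inj₁ (inj₂ (r , inj₂ a))
  pattern tail e       = inj₂ e

  offset-I↔ : Fin bI ↔ Offset-I
  offset-I↔ = ↔-trans Fin-suc↔ (↔-refl ⊎-↔ ↔-trans +↔⊎ (↔-refl ⊎-↔ +↔⊎))

  location↔ : Fin newPerimeter ↔ Location
  location↔ = ↔-trans +↔⊎
    (↔-trans +↔⊎ (↔-trans *↔× (↔-refl ×-↔ offset-I↔) ⊎-↔ ↔-trans *↔× (↔-refl ×-↔ Fin-suc↔)) ⊎-↔ ↔-refl)

  offset-I : Offset-I → ℕ
  offset-I (inj₁ _)               = 0
  offset-I (inj₂ (inj₁ a))        = suc (toℕ a)
  offset-I (inj₂ (inj₂ (inj₁ b))) = suc (u + toℕ b)
  offset-I (inj₂ (inj₂ (inj₂ a))) = suc (u + (u + toℕ a))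

  offset-N : Offset-N → ℕ
  offset-N (inj₁ _) = 0
  offset-N (inj₂ a) = suc (toℕ a)

  locPosition : Location → ℕ
  locPosition (inj₁ (inj₁ (r , o))) = bI * toℕ r + offset-I o
  locPosition (inj₁ (inj₂ (r , o))) = J * bI + (bN * toℕ r + offset-N o)
  locPosition (inj₂ e)              = J * bI + M * bN + toℕ e

  toℕ-offset-I : ∀ o → toℕ (Inverse.from offset-I↔ o) ≡ offset-I o
  toℕ-offset-I (inj₁ _)               = refl
  toℕ-offset-I (inj₂ (inj₁ a))        = cong suc (toℕ-↑ˡ a (u + u))
  toℕ-offset-I (inj₂ (inj₂ (inj₁ b))) = cong suc (trans (toℕ-↑ʳ u (b ↑ˡ u)) (cong (u +_) (toℕ-↑ˡ b u)))
  toℕ-offset-I (inj₂ (inj₂ (inj₂ a))) = cong suc (trans (toℕ-↑ʳ u (u ↑ʳ a)) (cong (u +_) (toℕ-↑ʳ u a)))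

  toℕ-offset-N : ∀ o → toℕ (Inverse.from (Fin-suc↔ {suc (u + u)}) o) ≡ offset-N o
  toℕ-offset-N (inj₁ _) = refl
  toℕ-offset-N (inj₂ a) = refl

  toℕ-location : ∀ x → toℕ (Inverse.from location↔ x) ≡ locPosition x
  toℕ-location (inj₁ (inj₁ (r , o))) = begin-equality
    toℕ (Inverse.from location↔ (inj₁ (inj₁ (r , o)))) ≡⟨ trans (toℕ-↑ˡ _ R) (toℕ-↑ˡ _ (M * bN)) ⟩
    toℕ (combine r (Inverse.from offset-I↔ o))          ≡⟨ toℕ-combine r _ ⟩
    bI * toℕ r + toℕ (Inverse.from offset-I↔ o)         ≡⟨ cong (bI * toℕ r +_) (toℕ-offset-I o) ⟩
    bI * toℕ r + offset-I o                             ∎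
  toℕ-location (inj₁ (inj₂ (r , o))) = begin-equality
    toℕ (Inverse.from location↔ (inj₁ (inj₂ (r , o))))  ≡⟨ trans (toℕ-↑ˡ _ R) (toℕ-↑ʳ (J * bI) _) ⟩
    J * bI + toℕ (combine r (Inverse.from Fin-suc↔ o))  ≡⟨ cong (J * bI +_) (toℕ-combine r _) ⟩
    J * bI + (bN * toℕ r + toℕ (Inverse.from Fin-suc↔ o))
      ≡⟨ cong (λ x → J * bI + (bN * toℕ r + x)) (toℕ-offset-N o) ⟩
    J * bI + (bN * toℕ r + offset-N o)                  ∎
  toℕ-location (inj₂ e) = toℕ-↑ʳ (J * bI + M * bN) e

  locVertex : Location → V selection
  locVertex (I-kept r)     = kept _ (r+r<L (<J⇒<K (toℕ<n r)))
  locVertex (I-path r a)   = path (<J⇒<K (toℕ<n r)) (Fin-u<1+2u a)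
  locVertex (I-detour r b) = detour (toℕ<n r) b
  locVertex (I-return r a) = path (<J⇒<K (toℕ<n r)) (return<1+2u a)
  locVertex (N-kept r)     = kept _ (r+r<L (J+r<K r))
  locVertex (N-path r a)   = path (J+r<K r) (toℕ<n a)
  locVertex (tail e)       = kept _ (tail<L e)

  locVertex-on : ∀ x → InB selection (locVertex x)
  locVertex-on (I-kept r)     = kept-on (r+r<L (<J⇒<K (toℕ<n r))) (even-unexpanded (toℕ r))
  locVertex-on (I-path r a)   = path-on (<J⇒<K (toℕ<n r)) (Fin-u<1+2u a) (λ _ → <⇒≢ (toℕ<n a))
  locVertex-on (I-detour r b) = tt
  locVertex-on (I-return r a) =
    path-on (<J⇒<K (toℕ<n r)) (return<1+2u a) (λ _ → ≢-sym (<⇒≢ (s≤s (m≤m+n u (toℕ a)))))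
  locVertex-on (N-kept r)     = kept-on (r+r<L (J+r<K r)) (even-unexpanded (J + toℕ r))
  locVertex-on (N-path r a)   =
    path-on (J+r<K r) (toℕ<n a) (λ J+r<J → contradiction J+r<J (≤⇒≯ (m≤m+n J (toℕ r))))
  locVertex-on (tail e)       = kept-on (tail<L e) (tail-unexpanded (toℕ e))

  blockStart-I′ : (r : Fin J) → blockStart (toℕ r) ≡ bI * toℕ r
  blockStart-I′ r = blockStart-I (<⇒≤ (toℕ<n r))

  position-locVertex : ∀ x → position (locVertex x) ≡ locPosition x
  position-locVertex (I-kept r) = begin-equality
    position (locVertex (I-kept r)) ≡⟨ position-kept (r+r<L (<J⇒<K (toℕ<n r))) ⟩
    keptPosition (toℕ r + toℕ r)            ≡⟨ keptPosition-even (<⇒≤ (<J⇒<K (toℕ<n r))) ⟩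
    blockStart (toℕ r)              ≡⟨ blockStart-I′ r ⟩
    bI * toℕ r                      ≡⟨ +-identityʳ _ ⟨
    bI * toℕ r + 0                  ∎
  position-locVertex (I-path r a) = trans (position-path (<J⇒<K (toℕ<n r)) (Fin-u<1+2u a))
    (cong₂ _+_ (blockStart-I′ r) (pathOffset-plain (λ (_ , u<a) → <-asym u<a (toℕ<n a))))
  position-locVertex (I-detour r b) =
    trans (position-detour (toℕ<n r) b) (cong (_+ suc (u + toℕ b)) (blockStart-I′ r))
  position-locVertex (I-return r a) = trans (position-path (<J⇒<K (toℕ<n r)) (return<1+2u a))
    (cong₂ _+_ (blockStart-I′ r) (trans (pathOffset-I (toℕ<n r) (s≤s (m≤m+n u (toℕ a)))) (+-suc u (u + toℕ a))))
  position-locVertex (N-kept r) = begin-equality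
    position (locVertex (N-kept r))       ≡⟨ position-kept (r+r<L (J+r<K r)) ⟩
    keptPosition ((J + toℕ r) + (J + toℕ r))      ≡⟨ keptPosition-even (<⇒≤ (J+r<K r)) ⟩
    blockStart (J + toℕ r)                ≡⟨ blockStart-N (toℕ r) ⟩
    J * bI + bN * toℕ r                   ≡⟨ cong (J * bI +_) (+-identityʳ _) ⟨
    J * bI + (bN * toℕ r + 0)             ∎
  position-locVertex (N-path r a) = begin-equality
    position (locVertex (N-path r a))                          ≡⟨ position-path (J+r<K r) (toℕ<n a) ⟩
    blockStart (J + toℕ r) + pathOffset (J + toℕ r) (toℕ a)
      ≡⟨ cong₂ _+_ (blockStart-N (toℕ r)) (pathOffset-plain (≤⇒≯ (m≤m+n J (toℕ r)) ∘ proj₁)) ⟩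
    J * bI + bN * toℕ r + suc (toℕ a)                          ≡⟨ +-assoc (J * bI) _ _ ⟩
    J * bI + (bN * toℕ r + suc (toℕ a))                        ∎
  position-locVertex (tail e) = begin-equality
    position (locVertex (tail e))  ≡⟨ position-kept (tail<L e) ⟩
    keptPosition (K + K + toℕ e)           ≡⟨ keptPosition-tail (toℕ e) ⟩
    blockStart K + toℕ e           ≡⟨ cong (_+ toℕ e) blockStart-K ⟩
    J * bI + M * bN + toℕ e        ∎

  locate-kept : ∀ q → ¬ Expanded (toℕ q) → ∃ λ x → locVertex x ≡ inj₁ (c′ q)
  locate-kept q q-kept with unexpanded-view (toℕ q) q-kept
  ... | inj₂ (e , q≡) =
    tail (fromℕ< e<R) , kept-≡ (tail<L (fromℕ< e<R)) (trans (cong (K + K +_) (toℕ-fromℕ< e<R)) (sym q≡))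
    where
    e<R : e < R
    e<R = +-cancelˡ-< (K + K) e R (subst (_< K + K + R) q≡ (subst (toℕ q <_) (sym K+K+R≡L) (toℕ<n q)))
  ... | inj₁ (r , r<K , q≡) with r <? J
  ...   | yes r<J = I-kept (fromℕ< r<J) ,
    kept-≡ (r+r<L (<J⇒<K (toℕ<n (fromℕ< r<J)))) (trans (cong (λ x → x + x) (toℕ-fromℕ< r<J)) (sym q≡))
  ...   | no r≮J with m≤n⇒∃[o]m+o≡n (≮⇒≥ r≮J)
  ...     | r′ , refl = N-kept (fromℕ< r′<M) ,
    kept-≡ (r+r<L (J+r<K (fromℕ< r′<M))) (trans (cong (λ x → (J + x) + (J + x)) (toℕ-fromℕ< r′<M)) (sym q≡))
    where
    r′<M : r′ < M
    r′<M = +-cancelˡ-< J r′ M r<K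

  locate-N-path : ∀ p p-exp a → suc (block p + block p) ≡ toℕ p → block p < K → ¬ block p < J →
    ∃ λ x → locVertex x ≡ inj₂ (inj₁ ((p , p-exp) , a))
  locate-N-path p p-exp a p≡ h<K h≮J =
    let r′ , r′≡ = m≤n⇒∃[o]m+o≡n (≮⇒≥ h≮J)
        r′<M = +-cancelˡ-< J r′ M (subst (_< K) (sym r′≡) h<K)
        a<1+2u = subst (toℕ a <_) NP≡ (toℕ<n a)
    in N-path (fromℕ< r′<M) (fromℕ< a<1+2u) ,
       path-≡ (J+r<K (fromℕ< r′<M)) (toℕ<n (fromℕ< a<1+2u))
         (trans (cong (λ x → suc ((J + x) + (J + x))) (toℕ-fromℕ< r′<M)) (trans (cong (λ x → suc (x + x)) r′≡) p≡))
         (toℕ-fromℕ< a<1+2u)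

  locate-I-path : ∀ p p-exp a → suc (block p + block p) ≡ toℕ p → (h<J : block p < J) → toℕ a ≢ u →
    ∃ λ x → locVertex x ≡ inj₂ (inj₁ ((p , p-exp) , a))
  locate-I-path p p-exp a p≡ h<J a≢u with toℕ a <? u
  ... | yes a<u = I-path (fromℕ< h<J) (fromℕ< a<u) ,
    path-≡ (<J⇒<K (toℕ<n (fromℕ< h<J))) (Fin-u<1+2u (fromℕ< a<u))
      (trans (cong (λ x → suc (x + x)) (toℕ-fromℕ< h<J)) p≡) (toℕ-fromℕ< a<u)
  ... | no a≮u =
    let a′ , a′≡ = m≤n⇒∃[o]m+o≡n (≤∧≢⇒< (≮⇒≥ a≮u) (≢-sym a≢u))
        a′<u = +-cancelˡ-< (suc u) a′ u (subst (_< suc (u + u)) (sym a′≡) (subst (toℕ a <_) NP≡ (toℕ<n a)))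
    in I-return (fromℕ< h<J) (fromℕ< a′<u) ,
       path-≡ (<J⇒<K (toℕ<n (fromℕ< h<J))) (return<1+2u (fromℕ< a′<u))
         (trans (cong (λ x → suc (x + x)) (toℕ-fromℕ< h<J)) p≡)
         (trans (cong (suc ∘ (u +_)) (toℕ-fromℕ< a′<u)) a′≡)

  locate-path : ∀ p p-exp a → (T (I (p , p-exp)) → toℕ a ≢ u) →
    ∃ λ x → locVertex x ≡ inj₂ (inj₁ ((p , p-exp) , a))
  locate-path p p-exp a a-on with toWitness p-exp | J ≤? block p
  ... | p≡ , h<K | yes J≤h = locate-N-path p p-exp a (sym p≡) h<K (≤⇒≯ J≤h)
  ... | p≡ , _   | no J≰h  = locate-I-path p p-exp a (sym p≡) (≰⇒> J≰h) (a-on (fromWitness (≰⇒> J≰h)))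

  locate : ∀ v → InB selection v → ∃ λ x → locVertex x ≡ v
  locate (inj₁ _) (q , q-kept , refl)                  = locate-kept q (q-kept ∘ fromWitness)
  locate (inj₂ (inj₁ ((p , p-exp) , a))) a-on          = locate-path p p-exp a a-on
  locate (inj₂ (inj₂ (((p , p-exp) , in-I) , b))) _    = I-detour (fromℕ< h<J) b ,
    detour-≡ (toℕ<n (fromℕ< h<J)) b
      (trans (cong (λ x → suc (x + x)) (toℕ-fromℕ< h<J)) (sym (proj₁ (toWitness p-exp))))
    where
    h<J : block p < J
    h<J = toWitness in-I

  layout : CyclicLayout (Ex selection) (InB selection) newPerimeter
  layout = record
    { vertex          = locVertex ∘ to
    ; position        = position
    ; position-vertex = λ i → trans (position-locVertex (to i))
                          (trans (sym (toℕ-location (to i))) (cong toℕ (strictlyInverseʳ i)))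
    ; vertex-on       = locVertex-on ∘ to
    ; vertex-onto     = λ v v-on → let x , x↦v = locate v v-on in
                          from x , trans (cong locVertex (strictlyInverseˡ x)) x↦v
    ; successor       = successor
    ; edge-adjacent   = λ x-on y-on → [ adjacent x-on y-on , swap ∘ adjacent y-on x-on ]
    }
    where open Inverse location↔

  canonical-territory : 3 ≤ newPerimeter →
    Σ ℕ λ n → Σ (Graph n) λ G → Σ (InducedCycle G) λ B → perimeter B ≡ newPerimeter × Canonical t G B
  canonical-territory 3≤newPerimeter =
    let n , G , B , B-length , iso = territory-from-layout layout
          (expansion-finite t selection (Tm-finite t m))
          swap (expansion-irreflexive t selection (Tm-irreflexive t m (s≤s (s≤s z≤n)))) 3≤newPerimeter
    in n , G , B , B-length , m , selection , iso

theorem3p1 : (t : ℕ) → 5 ≤ t → (l : ℕ) → 2 ∣ l → t ^ 3 ≤ l →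
    Σ ℕ λ n → Σ (Graph n) λ G → Σ (InducedCycle G) λ B →
      perimeter B ≡ l × Canonical t G B
theorem3p1 t 5≤t l 2∣l t³≤l with m≤n⇒∃[o]m+o≡n 5≤t
... | w , refl =
  let m , J , M , R , R>0 , K+K+R≡L , perimeter≡l = Arithmetic.perimeter-decomposition w l 2∣l t³≤l
      n , G , B , B-length , canonical = Construction.canonical-territory w m J M R R>0 K+K+R≡L
        (subst (3 ≤_) (sym perimeter≡l) (≤-trans (s≤s (s≤s (s≤s z≤n))) t³≤l))
  in n , G , B , trans B-length perimeter≡l , canonical
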